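{- (a) For any permutation $\pi$ of length $n\ge1$, $0\le\mathrm{pk}(\pi)\le\lfloor(n-1)/2\rfloor$ and $\mathrm{pk}(\pi)\le\mathrm{des}(\pi)\le n-\mathrm{pk}(\pi)-1$. (b) If $n\ge1$, $0\le j\le\lfloor(n-1)/2\rfloor$ and $j\le k\le n-j-1$, then there exists a permutation $\pi$ of length $n$ with $\mathrm{pk}(\pi)=j$ and $\mathrm{des}(\pi)=k$.
   Context: A permutation of length $n$ is a sequence $\pi=\pi_1\cdots\pi_n$ of distinct positive integers. $\mathrm{des}(\pi)$ is the number of $i\in[n-1]$ with $\pi_i>\pi_{i+1}$; a peak is an index $2\le i\le n-1$ with $\pi_{i-1}<\pi_i>\pi_{i+1}$, and $\mathrm{pk}(\pi)$ is the number of peaks. -}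

module Defs where

open import Data.Nat using (ℕ; zero; suc; _+_; _<_; _<ᵇ_)
open import Data.Bool using (Bool; true; false; _∧_; if_then_else_)
open import Data.List using (List; []; _∷_; length)
open import Data.List.Relation.Unary.All using (All)
open import Data.List.Relation.Unary.Unique.Propositional using (Unique)
open import Data.Product using (_×_)
open import Relation.Binary.PropositionalEquality using (_≡_)

IsPerm : ℕ → List ℕ → Set
IsPerm n π = (length π ≡ n) × Unique π × All (λ x → 0 < x) π

des : List ℕ → ℕ
des []             = 0
des (x ∷ [])       = 0
des (x ∷ y ∷ rest) = (if y <ᵇ x then 1 else 0) + des (y ∷ rest)

pk : List ℕ → ℕ
pk []                 = 0
pk (x ∷ [])           = 0
pk (x ∷ y ∷ [])       = 0
pk (x ∷ y ∷ z ∷ rest) = (if (x <ᵇ y) ∧ (z <ᵇ y) then 1 else 0) + pk (y ∷ z ∷ rest)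

module Submission where

-- Every peak π_i is immediately preceded by an
--     ascent (π_{i-1} < π_i) and immediately followed by a descent
--     (π_i > π_{i+1}), and no adjacent pair is both an ascent and a descent.
--     Hence pk ≤ des, pk ≤ asc and des + asc ≤ n - 1, from which
--     2·pk ≤ n - 1 and des + pk ≤ n - 1 follow.  None of this needs the entries
--     to be distinct: the counting lemmas hold for arbitrary lists of naturals.
--
-- (b) Write k = j + d and n = j + k + 1 + e.  Starting from the increasing run
--     1, 2, …, e+1 (no descents, no peaks), prepend d times a new maximum
--     (each adds one descent and no peak), then j times a pair a, a+1 with a the
--     next unused value (each adds one peak and one descent).  All operations
--     keep the list a permutation of {1, …, length}; the statistics are tracked
--     by a generic lemma about iterating an operation that raises a statistic
--     by a fixed amount.

open import Defs
open import Data.Nat using (ℕ; _≤_; _∸_; _/_; _+_)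
open import Data.List using (List)
open import Data.Product using (_×_; Σ-syntax)
open import Relation.Binary.PropositionalEquality using (_≡_)

open import Algebra.Properties.CommutativeSemigroup using (interchange)
open import Data.Bool using (true; false; _∧_; if_then_else_)
open import Data.Bool.Properties using (T-≡)
open import Data.Empty using (⊥-elim)
open import Data.List using ([]; _∷_; length)
open import Data.List.Relation.Unary.All as All using (All; []; _∷_)
open import Data.List.Relation.Unary.AllPairs using ([]; _∷_)
open import Data.List.Relation.Unary.Unique.Propositional using (Unique)
open import Data.Nat using (suc; _<_; _<ᵇ_; _*_; z≤n; s≤s; z<s; s≤s⁻¹)
open import Data.Nat.DivMod using (m*n/n≡m; /-monoˡ-≤; m/n≤m)
open import Data.Nat.GeneralisedArithmetic using (fold)
open import Data.Nat.Properties
open import Data.Nat.Tactic.RingSolver using (solve-∀)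
open import Data.Product using (_,_; proj₁)
open import Function using (_∘_; Equivalence)
open import Relation.Binary using (tri<; tri≈; tri>)
open import Relation.Binary.PropositionalEquality using (refl; sym; trans; cong; subst; ≢-sym; module ≡-Reasoning)

<ᵇ-true : ∀ {m n} → m < n → (m <ᵇ n) ≡ true
<ᵇ-true = Equivalence.to T-≡ ∘ <⇒<ᵇ

<ᵇ-false : ∀ {m n} → n ≤ m → (m <ᵇ n) ≡ false
<ᵇ-false {m} {n} n≤m with m <ᵇ n in m<ᵇn
... | false = refl
... | true  = ⊥-elim (<⇒≱ (<ᵇ⇒< m n (Equivalence.from T-≡ m<ᵇn)) n≤m)

indicator-∧ˡ : ∀ a b → (if a ∧ b then 1 else 0) ≤ (if a then 1 else 0)
indicator-∧ˡ true  true  = ≤-refl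
indicator-∧ˡ true  false = z≤n
indicator-∧ˡ false _     = z≤n

indicator-∧ʳ : ∀ a b → (if a ∧ b then 1 else 0) ≤ (if b then 1 else 0)
indicator-∧ʳ true  _ = ≤-refl
indicator-∧ʳ false _ = z≤n

descent+ascent≤1 : ∀ x y → (if y <ᵇ x then 1 else 0) + (if x <ᵇ y then 1 else 0) ≤ 1
descent+ascent≤1 x y with <-cmp x y
... | tri< x<y _ _ rewrite <ᵇ-false {y} {x} (<⇒≤ x<y) | <ᵇ-true x<y = ≤-refl
... | tri≈ _ refl _ rewrite <ᵇ-false {x} {x} ≤-refl = z≤n
... | tri> _ _ y<x rewrite <ᵇ-true y<x | <ᵇ-false {x} {y} (<⇒≤ y<x) = ≤-refl

asc : List ℕ → ℕ
asc []             = 0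
asc (x ∷ [])       = 0
asc (x ∷ y ∷ rest) = (if x <ᵇ y then 1 else 0) + asc (y ∷ rest)

-- Each peak is the top of an ascent.
pk≤asc : ∀ π → pk π ≤ asc π
pk≤asc []              = z≤n
pk≤asc (x ∷ [])        = z≤n
pk≤asc (x ∷ y ∷ [])    = z≤n
pk≤asc (x ∷ y ∷ z ∷ r) = +-mono-≤ (indicator-∧ˡ (x <ᵇ y) (z <ᵇ y)) (pk≤asc (y ∷ z ∷ r))

-- Each peak is the top of a descent; the first entry is never a peak, so the
-- descents of the tail already suffice.
pk-cons≤des : ∀ x l → pk (x ∷ l) ≤ des l
pk-cons≤des x []          = z≤n
pk-cons≤des x (y ∷ [])    = z≤n
pk-cons≤des x (y ∷ z ∷ r) = +-mono-≤ (indicator-∧ʳ (x <ᵇ y) (z <ᵇ y)) (pk-cons≤des y (z ∷ r))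

des≤des-cons : ∀ x l → des l ≤ des (x ∷ l)
des≤des-cons x []      = z≤n
des≤des-cons x (y ∷ r) = m≤n+m (des (y ∷ r)) _

pk≤des : ∀ π → pk π ≤ des π
pk≤des []      = z≤n
pk≤des (x ∷ l) = ≤-trans (pk-cons≤des x l) (des≤des-cons x l)

-- A list of length n has n - 1 adjacent pairs, each a descent, an ascent or neither.
des+asc≤ : ∀ π → des π + asc π ≤ length π ∸ 1
des+asc≤ []          = z≤n
des+asc≤ (x ∷ [])    = z≤n
des+asc≤ (x ∷ y ∷ r) = begin
  (a + des (y ∷ r)) + (b + asc (y ∷ r)) ≡⟨ interchange +-commutativeSemigroup a (des (y ∷ r)) b (asc (y ∷ r)) ⟩
  (a + b) + (des (y ∷ r) + asc (y ∷ r)) ≤⟨ +-mono-≤ (descent+ascent≤1 x y) (des+asc≤ (y ∷ r)) ⟩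
  suc (length r)                        ∎
  where
    open ≤-Reasoning
    a = if y <ᵇ x then 1 else 0
    b = if x <ᵇ y then 1 else 0

m+m≤n⇒m≤n/2 : ∀ {m n} → m + m ≤ n → m ≤ n / 2
m+m≤n⇒m≤n/2 {m} {n} m+m≤n = subst (_≤ n / 2) (m*n/n≡m m 2) (/-monoˡ-≤ 2 m*2≤n)
  where
    m*2≤n : m * 2 ≤ n
    m*2≤n = subst (_≤ n) (trans (cong (m +_) (sym (+-identityʳ m))) (*-comm 2 m)) m+m≤n

peak-descent-bounds : ∀ π → (pk π ≤ (length π ∸ 1) / 2) × (pk π ≤ des π × des π ≤ length π ∸ pk π ∸ 1)
peak-descent-bounds π = m+m≤n⇒m≤n/2 pk+pk≤ , pk≤des π , des≤
  where
    pk+pk≤ : pk π + pk π ≤ length π ∸ 1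
    pk+pk≤ = ≤-trans (+-mono-≤ (pk≤des π) (pk≤asc π)) (des+asc≤ π)
    des+pk≤ : des π + pk π ≤ length π ∸ 1
    des+pk≤ = ≤-trans (+-monoʳ-≤ (des π) (pk≤asc π)) (des+asc≤ π)
    reorder : length π ∸ 1 ∸ pk π ≡ length π ∸ pk π ∸ 1
    reorder = trans (∸-+-assoc (length π) 1 (pk π))
                (trans (cong (length π ∸_) (+-comm 1 (pk π))) (sym (∸-+-assoc (length π) (pk π) 1)))
    des≤ : des π ≤ length π ∸ pk π ∸ 1
    des≤ = subst (des π ≤_) reorder (m+n≤o⇒m≤o∸n (des π) des+pk≤)

des-ascent : ∀ {x y} r → x < y → des (x ∷ y ∷ r) ≡ des (y ∷ r)
des-ascent r x<y rewrite <ᵇ-false (<⇒≤ x<y) = refl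

des-descent : ∀ {x y} r → y < x → des (x ∷ y ∷ r) ≡ suc (des (y ∷ r))
des-descent r y<x rewrite <ᵇ-true y<x = refl

-- An entry followed by a smaller one is never the second entry of a peak.
pk-descent : ∀ {x y} r → y ≤ x → pk (x ∷ y ∷ r) ≡ pk (y ∷ r)
pk-descent []      y≤x = refl
pk-descent (z ∷ r) y≤x rewrite <ᵇ-false y≤x = refl

pk-rise-fall : ∀ {x y z} r → x < y → z < y → pk (x ∷ y ∷ z ∷ r) ≡ suc (pk (y ∷ z ∷ r))
pk-rise-fall r x<y z<y rewrite <ᵇ-true x<y | <ᵇ-true z<y = refl

-- A standard list is a nonempty permutation of {1, …, length} in one-line notation.
Standard : List ℕ → Set
Standard l = 1 ≤ length l × Unique l × All (λ x → 0 < x × x ≤ length l) l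

standard⇒IsPerm : ∀ {l} → Standard l → IsPerm (length l) l
standard⇒IsPerm (_ , unique , bounds) = refl , unique , All.map proj₁ bounds

standard-swap : ∀ {x y l} → Standard (x ∷ y ∷ l) → Standard (y ∷ x ∷ l)
standard-swap (nonempty , (x≢y ∷ x∉l) ∷ y∉l ∷ unique , bx ∷ by ∷ bounds) =
  nonempty , (≢-sym x≢y ∷ y∉l) ∷ x∉l ∷ unique , by ∷ bx ∷ bounds

ascending : ℕ → ℕ → List ℕ
ascending c 0       = []
ascending c (suc m) = c ∷ ascending (suc c) m

length-ascending : ∀ c m → length (ascending c m) ≡ m
length-ascending c 0       = refl
length-ascending c (suc m) = cong suc (length-ascending (suc c) m)

ascending-bounds : ∀ c m → All (λ x → c ≤ x × x < c + m) (ascending c m)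
ascending-bounds c 0       = []
ascending-bounds c (suc m) = (≤-refl , m<m+n c z<s) ∷ All.map widen (ascending-bounds (suc c) m)
  where
    widen : ∀ {x} → suc c ≤ x × x < suc c + m → c ≤ x × x < c + suc m
    widen {x} (c<x , x<) = <⇒≤ c<x , subst (x <_) (sym (+-suc c m)) x<

ascending-unique : ∀ c m → Unique (ascending c m)
ascending-unique c 0       = []
ascending-unique c (suc m) =
  All.map (λ (c<x , _) → <⇒≢ c<x) (ascending-bounds (suc c) m) ∷ ascending-unique (suc c) m

standard-ascending : ∀ m → Standard (ascending 1 (suc m))
standard-ascending m =
  s≤s z≤n , ascending-unique 1 (suc m) ,
  subst (λ len → All (λ x → 0 < x × x ≤ len) (ascending 1 (suc m)))
        (sym (length-ascending 1 (suc m)))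
        (All.map (λ (0<x , x<) → 0<x , s≤s⁻¹ x<) (ascending-bounds 1 (suc m)))

des-ascending : ∀ c m → des (ascending c m) ≡ 0
des-ascending c 0             = refl
des-ascending c 1             = refl
des-ascending c (suc (suc m)) =
  trans (des-ascent (ascending (suc (suc c)) m) (n<1+n c)) (des-ascending (suc c) (suc m))

pk-ascending : ∀ c m → pk (ascending c m) ≡ 0
pk-ascending c m = n≤0⇒n≡0 (subst (pk (ascending c m) ≤_) (des-ascending c m) (pk≤des (ascending c m)))

push : List ℕ → List ℕ
push l = suc (length l) ∷ l

standard-push : ∀ {l} → Standard l → Standard (push l)
standard-push (_ , unique , bounds) =
  s≤s z≤n ,
  All.map (λ (_ , x≤) → >⇒≢ (s≤s x≤)) bounds ∷ unique ,
  (s≤s z≤n , ≤-refl) ∷ All.map (λ (0<x , x≤) → 0<x , m≤n⇒m≤1+n x≤) bounds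

des-push : ∀ {l} → Standard l → des (push l) ≡ 1 + des l
des-push {h ∷ t} (_ , _ , (_ , h≤) ∷ _) = des-descent t (s≤s h≤)

pk-push : ∀ {l} → Standard l → pk (push l) ≡ 0 + pk l
pk-push {h ∷ t} (_ , _ , (_ , h≤) ∷ _) = pk-descent t (m≤n⇒m≤1+n h≤)

-- Prepending a, a+1 for the next unused value a: one more peak and one more
-- descent.  It is push ∘ push with the two new entries exchanged.
peak : List ℕ → List ℕ
peak l = suc (length l) ∷ suc (suc (length l)) ∷ l

standard-peak : ∀ {l} → Standard l → Standard (peak l)
standard-peak = standard-swap ∘ standard-push ∘ standard-push

des-peak : ∀ {l} → Standard l → des (peak l) ≡ 1 + des l
des-peak {h ∷ t} (_ , _ , (_ , h≤) ∷ _) =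
  trans (des-ascent (h ∷ t) (n<1+n _)) (des-descent t (s≤s (m≤n⇒m≤1+n h≤)))

pk-peak : ∀ {l} → Standard l → pk (peak l) ≡ 1 + pk l
pk-peak {h ∷ t} (_ , _ , (_ , h≤) ∷ _) =
  trans (pk-rise-fall t (n<1+n _) (s≤s (m≤n⇒m≤1+n h≤)))
        (cong suc (pk-descent t (m≤n⇒m≤1+n (m≤n⇒m≤1+n h≤))))

module Iteration {a p} {A : Set a} (P : A → Set p) (f : A → A)
                 (f-preserves : ∀ {x} → P x → P (f x)) where

  fold-preserves : ∀ k {x} → P x → P (fold x f k)
  fold-preserves 0       px = px
  fold-preserves (suc k) px = f-preserves (fold-preserves k px)

  fold-raises : (s : A → ℕ) (c : ℕ) → (∀ {x} → P x → s (f x) ≡ c + s x) →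
                ∀ k {x} → P x → s (fold x f k) ≡ k * c + s x
  fold-raises s c raise 0       px = refl
  fold-raises s c raise (suc k) {x} px = begin
    s (f (fold x f k))      ≡⟨ raise (fold-preserves k px) ⟩
    c + s (fold x f k)      ≡⟨ cong (c +_) (fold-raises s c raise k px) ⟩
    c + (k * c + s x)       ≡⟨ +-assoc c (k * c) (s x) ⟨
    c + k * c + s x         ∎
    where open ≡-Reasoning

open Iteration Standard push standard-push
  renaming (fold-preserves to pushes-preserve; fold-raises to pushes-raise)
open Iteration Standard peak standard-peak
  renaming (fold-preserves to peaks-preserve; fold-raises to peaks-raise)

length-normal : ∀ j d e → j * 2 + (d * 1 + suc e) ≡ suc (j + (j + d) + e)
length-normal = solve-∀

pk-normal : ∀ j d → j * 1 + (d * 0 + 0) ≡ j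
pk-normal = solve-∀

des-normal : ∀ j d → j * 1 + (d * 1 + 0) ≡ j + d
des-normal = solve-∀

realise : ∀ j d e → Σ[ π ∈ List ℕ ] (IsPerm (suc (j + (j + d) + e)) π × pk π ≡ j × des π ≡ j + d)
realise j d e = π , subst (λ n → IsPerm n π) length-π (standard⇒IsPerm standard-π) , pk-π , des-π
  where
    run middle π : List ℕ
    run    = ascending 1 (suc e)
    middle = fold run push d
    π      = fold middle peak j
    standard-run : Standard run
    standard-run = standard-ascending e
    standard-middle : Standard middle
    standard-middle = pushes-preserve d standard-run
    standard-π : Standard π
    standard-π = peaks-preserve j standard-middle
    length-π : length π ≡ suc (j + (j + d) + e)
    length-π = begin
      length π                      ≡⟨ peaks-raise length 2 (λ _ → refl) j standard-middle ⟩
      j * 2 + length middle         ≡⟨ cong (j * 2 +_) (pushes-raise length 1 (λ _ → refl) d standard-run) ⟩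
      j * 2 + (d * 1 + length run)  ≡⟨ cong (λ r → j * 2 + (d * 1 + r)) (length-ascending 1 (suc e)) ⟩
      j * 2 + (d * 1 + suc e)       ≡⟨ length-normal j d e ⟩
      suc (j + (j + d) + e)         ∎
      where open ≡-Reasoning
    pk-π : pk π ≡ j
    pk-π = begin
      pk π                          ≡⟨ peaks-raise pk 1 pk-peak j standard-middle ⟩
      j * 1 + pk middle             ≡⟨ cong (j * 1 +_) (pushes-raise pk 0 pk-push d standard-run) ⟩
      j * 1 + (d * 0 + pk run)      ≡⟨ cong (λ r → j * 1 + (d * 0 + r)) (pk-ascending 1 (suc e)) ⟩
      j * 1 + (d * 0 + 0)           ≡⟨ pk-normal j d ⟩
      j                             ∎
      where open ≡-Reasoning
    des-π : des π ≡ j + d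
    des-π = begin
      des π                         ≡⟨ peaks-raise des 1 des-peak j standard-middle ⟩
      j * 1 + des middle            ≡⟨ cong (j * 1 +_) (pushes-raise des 1 des-push d standard-run) ⟩
      j * 1 + (d * 1 + des run)     ≡⟨ cong (λ r → j * 1 + (d * 1 + r)) (des-ascending 1 (suc e)) ⟩
      j * 1 + (d * 1 + 0)           ≡⟨ des-normal j d ⟩
      j + d                         ∎
      where open ≡-Reasoning

admissible-shape : ∀ {n j k} → 1 ≤ n → j ≤ (n ∸ 1) / 2 → j ≤ k → k ≤ n ∸ j ∸ 1 →
                   Σ[ d ∈ ℕ ] Σ[ e ∈ ℕ ] (k ≡ j + d × n ≡ suc (j + k + e))
admissible-shape {suc m} {j} {k} _ j≤half j≤k k≤ =
  k ∸ j , m ∸ (j + k) , sym (m+[n∸m]≡n j≤k) , cong suc (sym (m+[n∸m]≡n j+k≤m))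
  where
    j≤m : j ≤ m
    j≤m = ≤-trans j≤half (m/n≤m m 2)
    k≤m∸j : k ≤ m ∸ j
    k≤m∸j = subst (k ≤_) (trans (∸-+-assoc (suc m) j 1) (cong (suc m ∸_) (+-comm j 1))) k≤
    j+k≤m : j + k ≤ m
    j+k≤m = subst (_≤ m) (+-comm k j) (m≤o∸n⇒m+n≤o k j≤m k≤m∸j)

proposition2p5 :
    ((n : ℕ) → 1 ≤ n → (π : List ℕ) → IsPerm n π →
       (0 ≤ pk π × pk π ≤ (n ∸ 1) / 2)
       × (pk π ≤ des π × des π ≤ n ∸ pk π ∸ 1))
    × ((n j k : ℕ) → 1 ≤ n → 0 ≤ j → j ≤ (n ∸ 1) / 2 → j ≤ k → k ≤ n ∸ j ∸ 1 →
       Σ[ π ∈ List ℕ ] (IsPerm n π × pk π ≡ j × des π ≡ k))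
proposition2p5 = partA , partB
  where
    partA : (n : ℕ) → 1 ≤ n → (π : List ℕ) → IsPerm n π →
       (0 ≤ pk π × pk π ≤ (n ∸ 1) / 2) × (pk π ≤ des π × des π ≤ n ∸ pk π ∸ 1)
    partA .(length π) _ π (refl , _) with peak-descent-bounds π
    ... | pk≤half , rest = (z≤n , pk≤half) , rest
    partB : (n j k : ℕ) → 1 ≤ n → 0 ≤ j → j ≤ (n ∸ 1) / 2 → j ≤ k → k ≤ n ∸ j ∸ 1 →
       Σ[ π ∈ List ℕ ] (IsPerm n π × pk π ≡ j × des π ≡ k)
    partB n j k 1≤n _ j≤half j≤k k≤ with admissible-shape 1≤n j≤half j≤k k≤
    ... | d , e , refl , refl = realise j d e
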